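{- For every integer $n\geq 4$, the number of Fishburn permutations of length $n$ that simultaneously avoid the classical patterns $321$, $1423$ and $3124$ equals $F_n+2$, where $F_n$ is the Fibonacci number defined by $F_0=F_1=1$ and $F_n=F_{n-1}+F_{n-2}$ for $n\geq 2$.
   Context: A permutation of length $n$ is a rearrangement $\pi=\pi_1\cdots\pi_n$ of $[n]$. A permutation $\pi$ contains a classical pattern $p\in S_k$ if some subsequence of $\pi$ of length $k$ is order-isomorphic to $p$; otherwise it avoids $p$. A Fishburn permutation is a permutation $\pi$ for which there are no indices $i<j$ with $\pi_j<\pi_i<\pi_{i+1}$ and $\pi_i=\pi_j+1$. -}

module Defs where

open import Data.Nat using (ℕ; zero; suc; _+_; _<_)
open import Data.Fin using (Fin; toℕ)
open import Data.Fin.Base using (_<_)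
open import Data.Vec using (Vec; lookup)
open import Data.Product using (Σ; _×_; ∃-syntax)
open import Relation.Binary.PropositionalEquality using (_≡_; _≢_)
open import Relation.Nullary using (¬_)
open import Function.Definitions using (Injective)

fib : ℕ → ℕ
fib zero = 1
fib (suc zero) = 1
fib (suc (suc n)) = fib (suc n) + fib n

-- A permutation of length n in one-line notation: π = π_1 ⋯ π_n, stored as a
-- word of length n over Fin n (values 0..n-1 stand for 1..n, positions 0..n-1
-- stand for 1..n), which is a bijection [n] → [n] (injective suffices on Fin n).
IsPerm : ∀ {n} → Vec (Fin n) n → Set
IsPerm {n} w = Injective _≡_ _≡_ (lookup w)

Contains : ∀ {n k} → Vec (Fin n) n → Vec (Fin k) k → Set
Contains {n} {k} w p =
  Σ (Fin k → Fin n) λ ι →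
    (∀ (a b : Fin k) → a Data.Fin.Base.< b → ι a Data.Fin.Base.< ι b) ×
    (∀ (a b : Fin k) →
       (lookup p a Data.Fin.Base.< lookup p b → lookup w (ι a) Data.Fin.Base.< lookup w (ι b)) ×
       (lookup w (ι a) Data.Fin.Base.< lookup w (ι b) → lookup p a Data.Fin.Base.< lookup p b))

Avoids : ∀ {n k} → Vec (Fin n) n → Vec (Fin k) k → Set
Avoids w p = ¬ Contains w p

Fishburn : ∀ {n} → Vec (Fin n) n → Set
Fishburn {n} w =
  ¬ (Σ (Fin n) λ i → Σ (Fin n) λ j → Σ (Fin n) λ i' →
       (toℕ i' ≡ suc (toℕ i)) ×
       (i Data.Fin.Base.< j) ×
       (lookup w j Data.Fin.Base.< lookup w i) ×
       (lookup w i Data.Fin.Base.< lookup w i') ×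
       (toℕ (lookup w i) ≡ suc (toℕ (lookup w j))))

open import Data.Vec using (_∷_; [])
open import Data.Fin using (zero; suc)

p321 : Vec (Fin 3) 3
p321 = suc (suc zero) ∷ suc zero ∷ zero ∷ []

p1423 : Vec (Fin 4) 4
p1423 = zero ∷ suc (suc (suc zero)) ∷ suc zero ∷ suc (suc zero) ∷ []

p3124 : Vec (Fin 4) 4
p3124 = suc (suc zero) ∷ zero ∷ suc zero ∷ suc (suc (suc zero)) ∷ []

-- The set of Fishburn permutations of length n avoiding 321, 1423, 3124.
-- A permutation is identified with its one-line word; the proof components
-- are irrelevant, so two elements are equal iff their words are equal.
record FishAvoid (n : ℕ) : Set where
  constructor fa
  field
    word : Vec (Fin n) n
    .isPerm : IsPerm word
    .fishburn : Fishburn word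
    .av321 : Avoids word p321
    .av1423 : Avoids word p1423
    .av3124 : Avoids word p3124

-- Call a permutation good if it is Fishburn and avoids 321 and 312 (entries below are 1-based).
-- If a Fishburn, 321-avoiding permutation does not start with 1, its second entry is 1: a
-- smaller second entry b gives the 321 (π₁, b, 1), and a larger one leaves π₁ − 1 to the right
-- of the ascent π₁ π₂, which the Fishburn condition forbids. Avoiding 312 as well, the first
-- entry is at most 2, so a good permutation is 1 ⊕ σ or 21 ⊕ σ with σ good, and good
-- permutations are counted by Fₙ. In the theorem's class, a permutation starting with 1 or 21
-- is good, because a 312 behind the entry 1 would make a 1423. Any other member starts with an
-- entry ≥ 3, and avoiding 321, 1423 and 3124 forces it to be 3 1 4 5 ⋯ n 2 or n 1 2 ⋯ (n−1).

{-# OPTIONS --safe #-}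
module Submission where

open import Defs
open import Data.Nat using (ℕ; zero; suc; pred; >-nonZero; _+_; _∸_; _≤_; _<_; z≤n; s≤s; z<s; s<s; s≤s⁻¹; s<s⁻¹)
open import Data.Nat.Properties
open import Data.Fin as F using (Fin; zero; suc; toℕ; inject₁; fromℕ; _↑ˡ_; _↑ʳ_)
open import Data.Fin.Relation.Unary.Top as Top using (‵fromℕ; ‵inject₁)
open import Data.Fin.Properties as FP using (toℕ-injective; toℕ<n; toℕ-↑ˡ; toℕ-↑ʳ)
open import Data.Vec using (Vec; []; _∷_; _∷ʳ_; lookup; map; _++_; tabulate)
open import Data.Vec.Properties using (lookup-map; lookup-++ˡ; lookup-++ʳ; lookup∘tabulate; ≡-dec)
open import Data.Vec.Relation.Binary.Pointwise.Extensional using (ext; Pointwise-≡⇒≡)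
open import Data.Product using (∃-syntax; _×_; _,_; proj₁; proj₂)
open import Data.Sum using (_⊎_; inj₁; inj₂; [_,_])
open import Data.Empty using (⊥; ⊥-elim; ⊥-elim-irr)
open import Function using (_∘_; case_of_)
open import Function.Bundles using (_↔_; mk↔ₛ′)
open import Function.Properties.Inverse using (↔-refl; ↔-trans; ↔-sym)
open import Data.Sum.Function.Propositional using (_⊎-↔_)
open import Relation.Binary using (tri<; tri≈; tri>)
open import Relation.Binary.PropositionalEquality using (_≡_; _≢_; refl; sym; trans; cong; cong₂; subst; subst₂)
open import Relation.Nullary using (¬_; yes; no)
open import Relation.Nullary.Decidable using (recompute)

Word : ℕ → Set
Word n = Vec (Fin n) n

val : ∀ {n} → Word n → Fin n → ℕ
val w i = toℕ (lookup w i)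

Ascending : ∀ {k} → (Fin (suc k) → ℕ) → Set
Ascending {k} f = ∀ (a : Fin k) → f (inject₁ a) < f (suc a)

ascending⇒monotone : ∀ {k} (f : Fin (suc k) → ℕ) → Ascending f →
                     ∀ {a b} → toℕ a < toℕ b → f a < f b
ascending⇒monotone {suc k} f asc {zero}  {suc zero}    _         = asc zero
ascending⇒monotone {suc k} f asc {zero}  {suc (suc b)} _         =
  <-trans (asc zero) (ascending⇒monotone (f ∘ suc) (asc ∘ suc) {zero} {suc b} z<s)
ascending⇒monotone {suc k} f asc {suc a} {suc b}       (s<s a<b) =
  ascending⇒monotone (f ∘ suc) (asc ∘ suc) a<b

ascending-gap : ∀ {L} (g : Fin (suc L) → ℕ) → Ascending g → ∀ {a b} → toℕ a ≤ toℕ b → g a + (toℕ b ∸ toℕ a) ≤ g b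
ascending-gap g asc {zero}  {zero}  _ = ≤-reflexive (+-identityʳ _)
ascending-gap {suc L} g asc {zero} {suc b} _ = begin
  g zero + suc (toℕ b)   ≡⟨ +-suc (g zero) (toℕ b) ⟩
  suc (g zero) + toℕ b   ≤⟨ +-monoˡ-≤ (toℕ b) (asc zero) ⟩
  g (suc zero) + toℕ b   ≤⟨ ascending-gap (g ∘ suc) (asc ∘ suc) {zero} {b} z≤n ⟩
  g (suc b)              ∎
  where open ≤-Reasoning
ascending-gap {suc L} g asc {suc a} {suc b} a≤b = ascending-gap (g ∘ suc) (asc ∘ suc) (s≤s⁻¹ a≤b)

ascending-squeeze : ∀ {c L} (g : Fin (suc L) → ℕ) → Ascending g → c ≤ g zero → g (fromℕ L) < c + suc L →
                    ∀ r → g r ≡ c + toℕ r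
ascending-squeeze {c} {L} g asc c≤g₀ gₗ<c+L+1 r = ≤-antisym upper lower
  where
  r≤L = s≤s⁻¹ (toℕ<n r)
  lower : c + toℕ r ≤ g r
  lower = ≤-trans (+-monoˡ-≤ (toℕ r) c≤g₀) (ascending-gap g asc {zero} {r} z≤n)
  d = L ∸ toℕ r
  upper : g r ≤ c + toℕ r
  upper = s≤s⁻¹ (+-cancelʳ-< d (g r) (suc (c + toℕ r)) (begin-strict
    g r + d                            ≡⟨ cong (λ x → g r + (x ∸ toℕ r)) (sym (FP.toℕ-fromℕ L)) ⟩
    g r + (toℕ (fromℕ L) ∸ toℕ r)      ≤⟨ ascending-gap g asc {r} {fromℕ L} (subst (toℕ r ≤_) (sym (FP.toℕ-fromℕ L)) r≤L) ⟩
    g (fromℕ L)             <⟨ gₗ<c+L+1 ⟩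
    c + suc L               ≡⟨ cong (λ x → c + suc x) (sym (m+[n∸m]≡n r≤L)) ⟩
    c + suc (toℕ r + d)     ≡⟨ +-suc c _ ⟩
    suc (c + (toℕ r + d))   ≡⟨ cong suc (sym (+-assoc c (toℕ r) d)) ⟩
    suc (c + toℕ r) + d     ∎))
    where open ≤-Reasoning

3≤-from≢ : ∀ {v} → v ≢ 0 → v ≢ 1 → v ≢ 2 → 3 ≤ v
3≤-from≢ {zero}              ≢0 _  _  = ⊥-elim (≢0 refl)
3≤-from≢ {suc zero}          _  ≢1 _  = ⊥-elim (≢1 refl)
3≤-from≢ {suc (suc zero)}    _  _  ≢2 = ⊥-elim (≢2 refl)
3≤-from≢ {suc (suc (suc _))} _  _  _  = s≤s (s≤s (s≤s z≤n))

lookup-∷ʳ-inject₁ : ∀ {A : Set} {n} (xs : Vec A n) x i → lookup (xs ∷ʳ x) (inject₁ i) ≡ lookup xs i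
lookup-∷ʳ-inject₁ (y ∷ ys) x zero    = refl
lookup-∷ʳ-inject₁ (y ∷ ys) x (suc i) = lookup-∷ʳ-inject₁ ys x i

lookup-∷ʳ-fromℕ : ∀ {A : Set} {n} (xs : Vec A n) x → lookup (xs ∷ʳ x) (fromℕ n) ≡ x
lookup-∷ʳ-fromℕ []       x = refl
lookup-∷ʳ-fromℕ (y ∷ ys) x = lookup-∷ʳ-fromℕ ys x

≗⇒≡ : ∀ {n} {w s : Word n} → (∀ i → val w i ≡ val s i) → w ≡ s
≗⇒≡ w≗s = Pointwise-≡⇒≡ (ext (toℕ-injective ∘ w≗s))

-- Pattern occurrences

contains-byChains : ∀ {n k} (w : Word n) (p : Word (suc k)) (ι : Fin (suc k) → Fin n)
  (p⁻¹ : Fin (suc k) → Fin (suc k)) → (∀ a → p⁻¹ (lookup p a) ≡ a) →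
  Ascending (toℕ ∘ ι) → Ascending (val w ∘ ι ∘ p⁻¹) → Contains w p
contains-byChains w p ι p⁻¹ p⁻¹∘p ι↑ v↑ =
  ι , (λ _ _ → ascending⇒monotone (toℕ ∘ ι) ι↑) , λ a b → preserves a b , reflects a b
  where
  v = val w ∘ ι
  preserves : ∀ a b → toℕ (lookup p a) < toℕ (lookup p b) → v a < v b
  preserves a b h = subst₂ (λ x y → v x < v y) (p⁻¹∘p a) (p⁻¹∘p b)
                           (ascending⇒monotone (v ∘ p⁻¹) v↑ h)
  reflects : ∀ a b → v a < v b → toℕ (lookup p a) < toℕ (lookup p b)
  reflects a b h with FP.<-cmp (lookup p a) (lookup p b)
  ... | tri< lt _ _ = lt
  ... | tri≈ _ e _  = ⊥-elim (<-irrefl (cong v (trans (sym (p⁻¹∘p a)) (trans (cong p⁻¹ e) (p⁻¹∘p b)))) h)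
  ... | tri> _ _ gt = ⊥-elim (<-asym h (preserves b a gt))

Occ321 Occ312 : ∀ {n} → Word n → Set
Occ321 w = ∃[ i ] ∃[ j ] ∃[ k ] (toℕ i < toℕ j × toℕ j < toℕ k × val w j < val w i × val w k < val w j)
Occ312 w = ∃[ i ] ∃[ j ] ∃[ k ] (toℕ i < toℕ j × toℕ j < toℕ k × val w j < val w k × val w k < val w i)

Occ1423 Occ3124 : ∀ {n} → Word n → Set
Occ1423 w = ∃[ i ] ∃[ j ] ∃[ k ] ∃[ l ] (toℕ i < toℕ j × toℕ j < toℕ k × toℕ k < toℕ l ×
                  val w i < val w k × val w k < val w l × val w l < val w j)
Occ3124 w = ∃[ i ] ∃[ j ] ∃[ k ] ∃[ l ] (toℕ i < toℕ j × toℕ j < toℕ k × toℕ k < toℕ l ×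
                  val w j < val w k × val w k < val w i × val w i < val w l)

module _ {n} (w : Word n) where

  contains⇒occ321 : Contains w p321 → Occ321 w
  contains⇒occ321 (ι , ι↑ , ord) =
    ι zero , ι (suc zero) , ι (suc (suc zero)) , ι↑ zero (suc zero) z<s , ι↑ (suc zero) (suc (suc zero)) (s<s z<s) ,
    proj₁ (ord (suc zero) zero) (s<s z<s) , proj₁ (ord (suc (suc zero)) (suc zero)) z<s

  contains⇒occ1423 : Contains w p1423 → Occ1423 w
  contains⇒occ1423 (ι , ι↑ , ord) =
    ι zero , ι (suc zero) , ι (suc (suc zero)) , ι (suc (suc (suc zero))) ,
    ι↑ zero (suc zero) z<s , ι↑ (suc zero) (suc (suc zero)) (s<s z<s) , ι↑ (suc (suc zero)) (suc (suc (suc zero))) (s<s (s<s z<s)) ,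
    proj₁ (ord zero (suc (suc zero))) z<s , proj₁ (ord (suc (suc zero)) (suc (suc (suc zero)))) (s<s z<s) ,
    proj₁ (ord (suc (suc (suc zero))) (suc zero)) (s<s (s<s z<s))

  contains⇒occ3124 : Contains w p3124 → Occ3124 w
  contains⇒occ3124 (ι , ι↑ , ord) =
    ι zero , ι (suc zero) , ι (suc (suc zero)) , ι (suc (suc (suc zero))) ,
    ι↑ zero (suc zero) z<s , ι↑ (suc zero) (suc (suc zero)) (s<s z<s) , ι↑ (suc (suc zero)) (suc (suc (suc zero))) (s<s (s<s z<s)) ,
    proj₁ (ord (suc zero) (suc (suc zero))) z<s , proj₁ (ord (suc (suc zero)) zero) (s<s z<s) ,
    proj₁ (ord zero (suc (suc (suc zero)))) (s<s (s<s z<s))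

  occ321⇒contains : Occ321 w → Contains w p321
  occ321⇒contains (i , j , k , i<j , j<k , wj<wi , wk<wj) =
    contains-byChains w p321 (lookup (i ∷ j ∷ k ∷ [])) (lookup p321)
      (λ { zero → refl ; (suc zero) → refl ; (suc (suc zero)) → refl })
      (λ { zero → i<j ; (suc zero) → j<k })
      (λ { zero → wk<wj ; (suc zero) → wj<wi })

  occ1423⇒contains : Occ1423 w → Contains w p1423
  occ1423⇒contains (i , j , k , l , i<j , j<k , k<l , wi<wk , wk<wl , wl<wj) =
    contains-byChains w p1423 (lookup (i ∷ j ∷ k ∷ l ∷ [])) (lookup (zero ∷ suc (suc zero) ∷ suc (suc (suc zero)) ∷ suc zero ∷ []))
      (λ { zero → refl ; (suc zero) → refl ; (suc (suc zero)) → refl ; (suc (suc (suc zero))) → refl })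
      (λ { zero → i<j ; (suc zero) → j<k ; (suc (suc zero)) → k<l })
      (λ { zero → wi<wk ; (suc zero) → wk<wl ; (suc (suc zero)) → wl<wj })

  occ3124⇒contains : Occ3124 w → Contains w p3124
  occ3124⇒contains (i , j , k , l , i<j , j<k , k<l , wj<wk , wk<wi , wi<wl) =
    contains-byChains w p3124 (lookup (i ∷ j ∷ k ∷ l ∷ [])) (lookup (suc zero ∷ suc (suc zero) ∷ zero ∷ suc (suc (suc zero)) ∷ []))
      (λ { zero → refl ; (suc zero) → refl ; (suc (suc zero)) → refl ; (suc (suc (suc zero))) → refl })
      (λ { zero → i<j ; (suc zero) → j<k ; (suc (suc zero)) → k<l })
      (λ { zero → wj<wk ; (suc zero) → wk<wi ; (suc (suc zero)) → wi<wl })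

lookup-surjective : ∀ {n} {w : Word n} → IsPerm w → ∀ y → ∃[ i ] lookup w i ≡ y
lookup-surjective {suc _} {w} perm y with FP.any? (λ i → lookup w i F.≟ y)
... | yes found = found
... | no absent with FP.pigeonhole (n<1+n _) (λ i → F.punchOut {i = y} (absent ∘ (i ,_) ∘ sym))
...   | i , j , i<j , e = ⊥-elim (FP.<-irrefl (perm {i} {j} (FP.punchOut-injective {i = y} (absent ∘ (i ,_) ∘ sym) (absent ∘ (j ,_) ∘ sym) e)) i<j)

module _ {n} (w : Word n) (perm : IsPerm w) where

  val-injective : ∀ {i j} → val w i ≡ val w j → i ≡ j
  val-injective e = perm (toℕ-injective e)

  val-≢ : ∀ {i j} → toℕ i ≢ toℕ j → val w i ≢ val w j
  val-≢ i≢j e = i≢j (cong toℕ (val-injective e))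

  positionOf : ∀ v → v < n → ∃[ i ] val w i ≡ v
  positionOf v v<n with lookup-surjective {w = w} perm (F.fromℕ< v<n)
  ... | i , e = i , trans (cong toℕ e) (FP.toℕ-fromℕ< v<n)

beyondFirst : ∀ {n} (w : Word (suc n)) {j} → val w j ≢ val w zero → 0 < toℕ j
beyondFirst _ {zero}  ≢first = ⊥-elim (≢first refl)
beyondFirst _ {suc _} _      = z<s

beyondFirstTwo : ∀ {n} (w : Word (2 + n)) {j} → val w j ≢ val w zero → val w j ≢ val w (suc zero) → 1 < toℕ j
beyondFirstTwo _ {zero}        ≢first _       = ⊥-elim (≢first refl)
beyondFirstTwo _ {suc zero}    _      ≢second = ⊥-elim (≢second refl)
beyondFirstTwo _ {suc (suc _)} _      _       = s<s z<s

module _ {m} (w : Word (2 + m)) (perm : IsPerm w) (av321 : ¬ Occ321 w) where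

  private
    a = val w zero
    b = val w (suc zero)

  second≡0 : Fishburn w → 0 < a → b ≡ 0
  second≡0 fish 0<a with b ≟ 0
  ... | yes b≡0 = b≡0
  ... | no b≢0 with <-cmp b a
  ...   | tri≈ _ b≡a _ = ⊥-elim (val-≢ w perm (λ ()) b≡a)
  ...   | tri< b<a _ _ =
    let (j , wj≡0) = positionOf w perm 0 z<s
        1<j = beyondFirstTwo w (λ e → <⇒≢ 0<a (trans (sym wj≡0) e)) (λ e → b≢0 (trans (sym e) wj≡0))
    in ⊥-elim (av321 (zero , suc zero , j , z<s , 1<j , b<a , subst (_< b) (sym wj≡0) (n≢0⇒n>0 b≢0)))
  ...   | tri> _ _ a<b =
    let (j , wj≡a-1) = positionOf w perm (pred a) (≤-<-trans pred[n]≤n (toℕ<n (lookup w zero)))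
        a≡1+wj : a ≡ suc (val w j)
        a≡1+wj = trans (sym (suc-pred a {{>-nonZero 0<a}})) (cong suc (sym wj≡a-1))
        wj<a = subst (val w j <_) (sym a≡1+wj) (n<1+n _)
        1<j = beyondFirstTwo w (<⇒≢ wj<a) (<⇒≢ (<-trans wj<a a<b))
    in ⊥-elim (fish (zero , j , suc zero , refl , <-trans z<s 1<j , wj<a , a<b , a≡1+wj))

  head<2 : ¬ Occ312 w → ¬ (2 ≤ a)
  head<2 av312 2≤a with positionOf w perm 0 z<s | positionOf w perm 1 (s<s z<s)
  ... | j₀ , w≡0 | j₁ , w≡1 with FP.<-cmp j₀ j₁
  ...   | tri< j₀<j₁ _ _ = av312 (zero , j₀ , j₁ , beyondFirst w (λ e → <⇒≢ (<-trans z<s 2≤a) (trans (sym w≡0) e)) ,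
                                  j₀<j₁ , subst₂ _<_ (sym w≡0) (sym w≡1) z<s , subst (_< a) (sym w≡1) 2≤a)
  ...   | tri≈ _ j₀≡j₁ _ = 0≢1+n (trans (sym w≡0) (trans (cong (val w) j₀≡j₁) w≡1))
  ...   | tri> _ _ j₁<j₀ = av321 (zero , j₁ , j₀ , beyondFirst w (λ e → <⇒≢ 2≤a (trans (sym w≡1) e)) , j₁<j₀ ,
                                  subst (_< a) (sym w≡1) 2≤a , subst₂ _<_ (sym w≡0) (sym w≡1) z<s)

-- Direct sums

record IsFish321-312 {n} (w : Word n) : Set where
  field
    isPerm    : IsPerm w
    fishburn  : Fishburn w
    avoids321 : ¬ Occ321 w
    avoids312 : ¬ Occ312 w

infixr 5 _⊕_
_⊕_ : ∀ {c m} → Word c → Word m → Word (c + m)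
_⊕_ {c} {m} π w = map (_↑ˡ m) π ++ map (c ↑ʳ_) w

data Side (c m : ℕ) : Fin (c + m) → Set where
  left  : (i : Fin c) → Side c m (i ↑ˡ m)
  right : (j : Fin m) → Side c m (c ↑ʳ j)

side : ∀ c {m} (x : Fin (c + m)) → Side c m x
side zero    j       = right j
side (suc c) zero    = left zero
side (suc c) (suc x) with side c x
... | left i  = left (suc i)
... | right j = right j

module DirectSum {c m} (π : Word c) (w : Word m) where

  private
    u = π ⊕ w

  val-left : ∀ i → val u (i ↑ˡ m) ≡ val π i
  val-left i = trans (cong toℕ (trans (lookup-++ˡ (map (_↑ˡ m) π) _ i) (lookup-map i (_↑ˡ m) π)))
                     (toℕ-↑ˡ (lookup π i) m)

  val-right : ∀ j → val u (c ↑ʳ j) ≡ c + val w j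
  val-right j = trans (cong toℕ (trans (lookup-++ʳ (map (_↑ˡ m) π) _ j) (lookup-map j (c ↑ʳ_) w)))
                      (toℕ-↑ʳ c (lookup w j))

  pos-left<right : ∀ (i : Fin c) (j : Fin m) → toℕ (i ↑ˡ m) < toℕ (c ↑ʳ j)
  pos-left<right i j = subst₂ _<_ (sym (toℕ-↑ˡ i m)) (sym (toℕ-↑ʳ c j)) (<-≤-trans (toℕ<n i) (m≤m+n c (toℕ j)))

  val-left<right : ∀ (i : Fin c) (j : Fin m) → val u (i ↑ˡ m) < val u (c ↑ʳ j)
  val-left<right i j = subst₂ _<_ (sym (val-left i)) (sym (val-right j)) (<-≤-trans (toℕ<n (lookup π i)) (m≤m+n c (val w j)))

  pos-left⁻ : ∀ {i i' : Fin c} → toℕ (i ↑ˡ m) < toℕ (i' ↑ˡ m) → toℕ i < toℕ i'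
  pos-left⁻ {i} {i'} = subst₂ _<_ (toℕ-↑ˡ i m) (toℕ-↑ˡ i' m)

  val-left⁻ : ∀ {i i' : Fin c} → val u (i ↑ˡ m) < val u (i' ↑ˡ m) → val π i < val π i'
  val-left⁻ {i} {i'} = subst₂ _<_ (val-left i) (val-left i')

  pos-right⁻ : ∀ {j j' : Fin m} → toℕ (c ↑ʳ j) < toℕ (c ↑ʳ j') → toℕ j < toℕ j'
  pos-right⁻ {j} {j'} h = +-cancelˡ-< c (toℕ j) (toℕ j') (subst₂ _<_ (toℕ-↑ʳ c j) (toℕ-↑ʳ c j') h)

  val-right⁻ : ∀ {j j' : Fin m} → val u (c ↑ʳ j) < val u (c ↑ʳ j') → val w j < val w j'
  val-right⁻ {j} {j'} h = +-cancelˡ-< c (val w j) (val w j') (subst₂ _<_ (val-right j) (val-right j') h)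

  pos-right⁺ : ∀ {j j' : Fin m} → toℕ j < toℕ j' → toℕ (c ↑ʳ j) < toℕ (c ↑ʳ j')
  pos-right⁺ {j} {j'} h = subst₂ _<_ (sym (toℕ-↑ʳ c j)) (sym (toℕ-↑ʳ c j')) (+-monoʳ-< c h)

  val-right⁺ : ∀ {j j' : Fin m} → val w j < val w j' → val u (c ↑ʳ j) < val u (c ↑ʳ j')
  val-right⁺ {j} {j'} h = subst₂ _<_ (sym (val-right j)) (sym (val-right j')) (+-monoʳ-< c h)

  ⊕-isPerm : IsPerm π → IsPerm w → IsPerm u
  ⊕-isPerm permπ permw {x} {y} e with side c x | side c y | cong toℕ e
  ... | left i  | left i'  | v≡ = cong (_↑ˡ m) (val-injective π permπ (trans (sym (val-left i)) (trans v≡ (val-left i'))))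
  ... | right j | right j' | v≡ = cong (c ↑ʳ_) (val-injective w permw
                                    (+-cancelˡ-≡ c _ _ (trans (sym (val-right j)) (trans v≡ (val-right j')))))
  ... | left i  | right j  | v≡ = ⊥-elim (<⇒≢ (val-left<right i j) v≡)
  ... | right j | left i   | v≡ = ⊥-elim (<⇒≢ (val-left<right i j) (sym v≡))

  ⊕-isPermʳ : IsPerm u → IsPerm w
  ⊕-isPermʳ permu {j} {j'} e = FP.↑ʳ-injective c j j' (permu (toℕ-injective
    (trans (val-right j) (trans (cong (λ y → c + toℕ y) e) (sym (val-right j'))))))

  -- An inversion never straddles the two summands, so each pattern built from inversions
  -- lies entirely in one summand.
  occ321-split : Occ321 u → Occ321 π ⊎ Occ321 w
  occ321-split (x , y , z , x<y , y<z , vy<vx , vz<vy) with side c x | side c y | side c z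
  ... | left i  | left i'  | left i''  = inj₁ (i , i' , i'' , pos-left⁻ x<y , pos-left⁻ y<z , val-left⁻ vy<vx , val-left⁻ vz<vy)
  ... | right j | right j' | right j'' = inj₂ (j , j' , j'' , pos-right⁻ x<y , pos-right⁻ y<z , val-right⁻ vy<vx , val-right⁻ vz<vy)
  ... | left i  | right j  | _        = ⊥-elim (<-asym vy<vx (val-left<right i j))
  ... | left _  | left i   | right j  = ⊥-elim (<-asym vz<vy (val-left<right i j))
  ... | right j | left i   | _        = ⊥-elim (<-asym x<y (pos-left<right i j))
  ... | right _ | right j  | left i   = ⊥-elim (<-asym y<z (pos-left<right i j))

  occ312-split : Occ312 u → Occ312 π ⊎ Occ312 w
  occ312-split (x , y , z , x<y , y<z , vy<vz , vz<vx) with side c x | side c y | side c z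
  ... | left i  | left i'  | left i''  = inj₁ (i , i' , i'' , pos-left⁻ x<y , pos-left⁻ y<z , val-left⁻ vy<vz , val-left⁻ vz<vx)
  ... | right j | right j' | right j'' = inj₂ (j , j' , j'' , pos-right⁻ x<y , pos-right⁻ y<z , val-right⁻ vy<vz , val-right⁻ vz<vx)
  ... | left i  | _        | right j  = ⊥-elim (<-asym vz<vx (val-left<right i j))
  ... | left _  | right j  | left i   = ⊥-elim (<-asym vy<vz (val-left<right i j))
  ... | right j | left i   | _        = ⊥-elim (<-asym x<y (pos-left<right i j))
  ... | right _ | right j  | left i   = ⊥-elim (<-asym y<z (pos-left<right i j))

  ⊕-fishburn : Fishburn π → Fishburn w → Fishburn u
  ⊕-fishburn fishπ fishw (x , y , x' , x'≡1+x , x<y , vy<vx , vx<vx' , vx≡1+vy) with side c x | side c y | side c x'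
  ... | left i  | left i'  | left i''  =
    fishπ (i , i' , i'' , trans (sym (toℕ-↑ˡ i'' m)) (trans x'≡1+x (cong suc (toℕ-↑ˡ i m))) , pos-left⁻ x<y ,
           val-left⁻ vy<vx , val-left⁻ vx<vx' , trans (sym (val-left i)) (trans vx≡1+vy (cong suc (val-left i'))))
  ... | right j | right j' | right j'' =
    fishw (j , j' , j'' , +-cancelˡ-≡ c _ _ (trans (sym (toℕ-↑ʳ c j'')) (trans x'≡1+x (trans (cong suc (toℕ-↑ʳ c j)) (sym (+-suc c _))))) ,
           pos-right⁻ x<y , val-right⁻ vy<vx , val-right⁻ vx<vx' ,
           +-cancelˡ-≡ c _ _ (trans (sym (val-right j)) (trans vx≡1+vy (trans (cong suc (val-right j')) (sym (+-suc c _))))))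
  ... | left i  | right j  | _        = ⊥-elim (<-asym vy<vx (val-left<right i j))
  ... | right j | left i   | _        = ⊥-elim (<-asym x<y (pos-left<right i j))
  ... | left _  | left i   | right j  = ⊥-elim (<⇒≱ (pos-left<right i j) (subst (_≤ _) (sym x'≡1+x) x<y))
  ... | right j | right _  | left i   = ⊥-elim (<-asym (pos-left<right i j) (subst (toℕ (c ↑ʳ j) <_) (sym x'≡1+x) (n<1+n _)))

  fishburnʳ : Fishburn u → Fishburn w
  fishburnʳ fishu (j , j' , j'' , j''≡1+j , j<j' , vj'<vj , vj<vj'' , vj≡1+vj') =
    fishu (c ↑ʳ j , c ↑ʳ j' , c ↑ʳ j'' ,
           trans (toℕ-↑ʳ c j'') (trans (cong (c +_) j''≡1+j) (trans (+-suc c _) (cong suc (sym (toℕ-↑ʳ c j))))) ,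
           pos-right⁺ j<j' , val-right⁺ vj'<vj , val-right⁺ vj<vj'' ,
           trans (val-right j) (trans (cong (c +_) vj≡1+vj') (trans (+-suc c _) (cong suc (sym (val-right j'))))))

  occ321ʳ : Occ321 w → Occ321 u
  occ321ʳ (j , j' , j'' , a , b , x , y) = c ↑ʳ j , c ↑ʳ j' , c ↑ʳ j'' , pos-right⁺ a , pos-right⁺ b , val-right⁺ x , val-right⁺ y

  occ312ʳ : Occ312 w → Occ312 u
  occ312ʳ (j , j' , j'' , a , b , x , y) = c ↑ʳ j , c ↑ʳ j' , c ↑ʳ j'' , pos-right⁺ a , pos-right⁺ b , val-right⁺ x , val-right⁺ y

  occ312ʳ⇒occ1423 : Fin c → Occ312 w → Occ1423 u
  occ312ʳ⇒occ1423 i (j , j' , j'' , a , b , x , y) =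
    i ↑ˡ m , c ↑ʳ j , c ↑ʳ j' , c ↑ʳ j'' , pos-left<right i j , pos-right⁺ a , pos-right⁺ b ,
    val-left<right i j' , val-right⁺ x , val-right⁺ y

  ⊕-isFish : IsFish321-312 π → IsFish321-312 w → IsFish321-312 u
  ⊕-isFish fπ fw = record
    { isPerm    = ⊕-isPerm (isPerm fπ) (isPerm fw)
    ; fishburn  = ⊕-fishburn (fishburn fπ) (fishburn fw)
    ; avoids321 = [ avoids321 fπ , avoids321 fw ] ∘ occ321-split
    ; avoids312 = [ avoids312 fπ , avoids312 fw ] ∘ occ312-split
    }
    where open IsFish321-312

  ⊕-isFishʳ : IsFish321-312 u → IsFish321-312 w
  ⊕-isFishʳ fu = record
    { isPerm    = ⊕-isPermʳ (isPerm fu)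
    ; fishburn  = fishburnʳ (fishburn fu)
    ; avoids321 = avoids321 fu ∘ occ321ʳ
    ; avoids312 = avoids312 fu ∘ occ312ʳ
    }
    where open IsFish321-312

noThreePositions : ∀ {n} {i j k : Fin n} → n ≤ 2 → toℕ i < toℕ j → toℕ j < toℕ k → ⊥
noThreePositions {k = k} n≤2 i<j j<k = <⇒≱ (<-≤-trans (toℕ<n k) n≤2) (≤-<-trans (≤-<-trans z≤n i<j) j<k)

π1 : Word 1
π1 = zero ∷ []

π21 : Word 2
π21 = suc zero ∷ zero ∷ []

π1-isFish : IsFish321-312 π1
π1-isFish = record
  { isPerm    = λ { {zero} {zero} _ → refl }
  ; fishburn  = λ { (zero , zero , _ , _ , () , _) }
  ; avoids321 = λ { (_ , _ , _ , i<j , j<k , _) → noThreePositions (s≤s z≤n) i<j j<k }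
  ; avoids312 = λ { (_ , _ , _ , i<j , j<k , _) → noThreePositions (s≤s z≤n) i<j j<k }
  }

π21-isFish : IsFish321-312 π21
π21-isFish = record
  { isPerm    = λ { {zero} {zero} _ → refl ; {suc zero} {suc zero} _ → refl ; {zero} {suc zero} () ; {suc zero} {zero} () }
  ; fishburn  = λ { (zero , suc zero , suc zero , _ , _ , _ , () , _)
                  ; (zero , suc zero , zero , () , _)
                  ; (zero , zero , _ , _ , () , _)
                  ; (suc zero , zero , _ , _ , () , _)
                  ; (suc zero , suc zero , _ , _ , s≤s () , _) }
  ; avoids321 = λ { (_ , _ , _ , i<j , j<k , _) → noThreePositions ≤-refl i<j j<k }
  ; avoids312 = λ { (_ , _ , _ , i<j , j<k , _) → noThreePositions ≤-refl i<j j<k }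
  }

strip : ∀ c {m k} (xs : Vec (Fin (c + m)) k) → .(∀ i → c ≤ toℕ (lookup xs i)) → Vec (Fin m) k
strip c []       _ = []
strip c (x ∷ xs) h = F.reduce≥ x (h zero) ∷ strip c xs (λ i → h (suc i))

↑ʳ-reduce≥ : ∀ c {m} (x : Fin (c + m)) .(h : c ≤ toℕ x) → c ↑ʳ F.reduce≥ x h ≡ x
↑ʳ-reduce≥ zero    x       _ = refl
↑ʳ-reduce≥ (suc c) (suc x) h = cong suc (↑ʳ-reduce≥ c x (s≤s⁻¹ h))

reduce≥-↑ʳ : ∀ c {m} (j : Fin m) .(h : c ≤ toℕ (c ↑ʳ j)) → F.reduce≥ (c ↑ʳ j) h ≡ j
reduce≥-↑ʳ zero    j _ = refl
reduce≥-↑ʳ (suc c) j h = reduce≥-↑ʳ c j (s≤s⁻¹ h)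

↑ʳ-strip : ∀ c {m k} (xs : Vec (Fin (c + m)) k) .(h : ∀ i → c ≤ toℕ (lookup xs i)) → map (c ↑ʳ_) (strip c xs h) ≡ xs
↑ʳ-strip c []       _ = refl
↑ʳ-strip c (x ∷ xs) h = cong₂ _∷_ (↑ʳ-reduce≥ c x (h zero)) (↑ʳ-strip c xs (λ i → h (suc i)))

strip-↑ʳ : ∀ c {m k} (ys : Vec (Fin m) k) .(h : ∀ i → c ≤ toℕ (lookup (map (c ↑ʳ_) ys) i)) → strip c (map (c ↑ʳ_) ys) h ≡ ys
strip-↑ʳ c []       _ = refl
strip-↑ʳ c (y ∷ ys) h = cong₂ _∷_ (reduce≥-↑ʳ c y (h zero)) (strip-↑ʳ c ys (λ i → h (suc i)))

aboveOne : ∀ {m} {xs : Vec (Fin (suc m)) m} → IsPerm (zero ∷ xs) → ∀ i → 1 ≤ toℕ (lookup xs i)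
aboveOne {xs = xs} perm i with lookup xs i in e
... | zero  = case perm {suc i} {zero} e of λ ()
... | suc _ = s≤s z≤n

aboveTwo : ∀ {m} {xs : Vec (Fin (2 + m)) m} → IsPerm (suc zero ∷ zero ∷ xs) → ∀ i → 2 ≤ toℕ (lookup xs i)
aboveTwo {xs = xs} perm i with lookup xs i in e
... | zero        = case perm {suc (suc i)} {suc zero} e of λ ()
... | suc zero    = case perm {suc (suc i)} {zero} e of λ ()
... | suc (suc _) = s≤s (s≤s z≤n)

-- Counting Fishburn permutations avoiding 321 and 312

record Fish321-312 (n : ℕ) : Set where
  constructor mk
  field
    word   : Word n
    .isFish : IsFish321-312 word

Fish321-312-≡ : ∀ {n} {s t : Fish321-312 n} → Fish321-312.word s ≡ Fish321-312.word t → s ≡ t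
Fish321-312-≡ {s = mk _ _} {t = mk _ _} refl = refl

data Start {m} : Word (2 + m) → Set where
  start0  : ∀ xs → Start (zero ∷ xs)
  start10 : ∀ xs → Start (suc zero ∷ zero ∷ xs)

start : ∀ {m} (u : Word (2 + m)) → .(IsFish321-312 u) → Start u
start (zero ∷ xs)               _ = start0 xs
start (suc zero ∷ zero ∷ xs)    _ = start10 xs
start u@(suc zero ∷ suc _ ∷ _) f = ⊥-elim-irr (0≢1+n (sym (second≡0 u (isPerm f) (avoids321 f) (fishburn f) z<s)))
  where open IsFish321-312
start u@(suc (suc _) ∷ _)      f = ⊥-elim-irr (head<2 u (isPerm f) (avoids321 f) (avoids312 f) (s≤s (s≤s z≤n)))
  where open IsFish321-312

module _ {m : ℕ} where

  peel : Fish321-312 (2 + m) → Fish321-312 (1 + m) ⊎ Fish321-312 m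
  peel (mk u f) with start u f
  ... | start0 xs  = inj₁ (mk (strip 1 xs (aboveOne (IsFish321-312.isPerm f)))
                            (DirectSum.⊕-isFishʳ π1 _ (subst IsFish321-312 (sym (cong (zero ∷_) (↑ʳ-strip 1 xs _))) f)))
  ... | start10 xs = inj₂ (mk (strip 2 xs (aboveTwo (IsFish321-312.isPerm f)))
                            (DirectSum.⊕-isFishʳ π21 _ (subst IsFish321-312 (sym (cong (λ ys → suc zero ∷ zero ∷ ys) (↑ʳ-strip 2 xs _))) f)))

  unpeel : Fish321-312 (1 + m) ⊎ Fish321-312 m → Fish321-312 (2 + m)
  unpeel (inj₁ (mk w f)) = mk (π1 ⊕ w) (DirectSum.⊕-isFish π1 w π1-isFish f)
  unpeel (inj₂ (mk w f)) = mk (π21 ⊕ w) (DirectSum.⊕-isFish π21 w π21-isFish f)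

  peel∘unpeel : ∀ x → peel (unpeel x) ≡ x
  peel∘unpeel (inj₁ (mk w _)) = cong inj₁ (Fish321-312-≡ (strip-↑ʳ 1 w _))
  peel∘unpeel (inj₂ (mk w _)) = cong inj₂ (Fish321-312-≡ (strip-↑ʳ 2 w _))

  unpeel∘peel : ∀ t → unpeel (peel t) ≡ t
  unpeel∘peel (mk u f) with start u f
  ... | start0 xs  = Fish321-312-≡ (cong (zero ∷_) (↑ʳ-strip 1 xs _))
  ... | start10 xs = Fish321-312-≡ (cong (λ ys → suc zero ∷ zero ∷ ys) (↑ʳ-strip 2 xs _))

  peel-↔ : Fish321-312 (2 + m) ↔ (Fish321-312 (1 + m) ⊎ Fish321-312 m)
  peel-↔ = mk↔ₛ′ peel unpeel peel∘unpeel unpeel∘peel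

[]-isFish : IsFish321-312 {0} []
[]-isFish = record { isPerm = λ { {()} } ; fishburn = λ () ; avoids321 = λ () ; avoids312 = λ () }

fib↔Fish321-312 : ∀ m → Fin (fib m) ↔ Fish321-312 m
fib↔Fish321-312 zero          = mk↔ₛ′ (λ _ → mk [] []-isFish) (λ _ → zero) (λ { (mk [] _) → refl }) (λ { zero → refl })
fib↔Fish321-312 (suc zero)    = mk↔ₛ′ (λ _ → mk π1 π1-isFish) (λ _ → zero) (λ { (mk (zero ∷ []) _) → refl }) (λ { zero → refl })
fib↔Fish321-312 (suc (suc m)) =
  ↔-trans FP.+↔⊎ (↔-trans (fib↔Fish321-312 (suc m) ⊎-↔ fib↔Fish321-312 m) (↔-sym peel-↔))

-- Fishburn permutations avoiding 321, 1423 and 3124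

occ1423⇒occ312 : ∀ {n} {w : Word n} → Occ1423 w → Occ312 w
occ1423⇒occ312 (_ , j , k , l , _ , j<k , k<l , _ , wk<wl , wl<wj) = j , k , l , j<k , k<l , wk<wl , wl<wj

occ3124⇒occ312 : ∀ {n} {w : Word n} → Occ3124 w → Occ312 w
occ3124⇒occ312 (i , j , k , _ , i<j , j<k , _ , wj<wk , wk<wi , _) = i , j , k , i<j , j<k , wj<wk , wk<wi

toFishAvoid : ∀ {n} → Fish321-312 n → FishAvoid n
toFishAvoid (mk w f) = fa w (isPerm f) (fishburn f) (avoids321 f ∘ contains⇒occ321 w)
                            (avoids312 f ∘ occ1423⇒occ312 {w = w} ∘ contains⇒occ1423 w)
                            (avoids312 f ∘ occ3124⇒occ312 {w = w} ∘ contains⇒occ3124 w)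
  where open IsFish321-312

isFish-afterPrefix : ∀ {c m} {π : Word c} {w : Word m} {u : Word (c + m)} → IsFish321-312 π → Fin c → π ⊕ w ≡ u →
                     IsPerm u → Fishburn u → Avoids u p321 → Avoids u p1423 → IsFish321-312 u
isFish-afterPrefix {π = π} {w} {u} fπ i refl perm fish av321 av1423 = record
  { isPerm    = perm
  ; fishburn  = fish
  ; avoids321 = av321 ∘ occ321⇒contains u
  ; avoids312 = [ IsFish321-312.avoids312 fπ , av1423 ∘ occ1423⇒contains u ∘ occ312ʳ⇒occ1423 i ] ∘ occ312-split
  }
  where open DirectSum π w

FishAvoid-≡ : ∀ {n} {s t : FishAvoid n} → FishAvoid.word s ≡ FishAvoid.word t → s ≡ t
FishAvoid-≡ {s = fa _ _ _ _ _ _} {t = fa _ _ _ _ _ _} refl = refl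

-- n 1 2 ⋯ (n−1) in 1-based one-line notation
maxFirst : ∀ k → Word (4 + k)
maxFirst k = fromℕ (3 + k) ∷ tabulate inject₁

module MaxFirst (k : ℕ) where

  val-head : val (maxFirst k) zero ≡ 3 + k
  val-head = FP.toℕ-fromℕ (3 + k)

  val-tail : ∀ r → val (maxFirst k) (suc r) ≡ toℕ r
  val-tail r = trans (cong toℕ (lookup∘tabulate inject₁ r)) (FP.toℕ-inject₁ r)

  inversion⇒head : ∀ {x y} → toℕ x < toℕ y → val (maxFirst k) y < val (maxFirst k) x → x ≡ zero
  inversion⇒head {zero}          _   _     = refl
  inversion⇒head {suc r} {suc s} r<s vs<vr = ⊥-elim (<-asym (s<s⁻¹ r<s) (subst₂ _<_ (val-tail s) (val-tail r) vs<vr))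

  head-maximal : ∀ x → ¬ (val (maxFirst k) zero < val (maxFirst k) x)
  head-maximal x = <⇒≱ (subst (val (maxFirst k) x <_) (cong suc (sym val-head)) (toℕ<n (lookup (maxFirst k) x)))

  isPerm : IsPerm (maxFirst k)
  isPerm {x} {y} e = injective x y (cong toℕ e)
    where
    injective : ∀ x y → val (maxFirst k) x ≡ val (maxFirst k) y → x ≡ y
    injective zero    zero    _ = refl
    injective (suc r) (suc s) e = cong suc (toℕ-injective (trans (sym (val-tail r)) (trans e (val-tail s))))
    injective zero    (suc s) e = ⊥-elim (<⇒≢ (subst₂ _<_ (sym (val-tail s)) (sym val-head) (toℕ<n s)) (sym e))
    injective (suc r) zero    e = ⊥-elim (<⇒≢ (subst₂ _<_ (sym (val-tail r)) (sym val-head) (toℕ<n r)) e)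

  fishburn : Fishburn (maxFirst k)
  fishburn (x , _ , x' , _ , x<y , vy<vx , vx<vx' , _) with inversion⇒head x<y vy<vx
  ... | refl = head-maximal x' vx<vx'

  avoids321 : ¬ Occ321 (maxFirst k)
  avoids321 (_ , j , _ , i<j , j<k , _ , vk<vj) with inversion⇒head j<k vk<vj
  ... | refl = n≮0 i<j

  avoids1423 : ¬ Occ1423 (maxFirst k)
  avoids1423 (_ , j , _ , _ , i<j , j<k , _ , _ , vk<vl , vl<vj) with inversion⇒head j<k (<-trans vk<vl vl<vj)
  ... | refl = n≮0 i<j

  avoids3124 : ¬ Occ3124 (maxFirst k)
  avoids3124 (_ , _ , _ , l , i<j , _ , _ , vj<vk , vk<vi , vi<vl) with inversion⇒head i<j (<-trans vj<vk vk<vi)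
  ... | refl = head-maximal l vi<vl

maxFirst-fishAvoid : ∀ k → FishAvoid (4 + k)
maxFirst-fishAvoid k = fa (maxFirst k) isPerm fishburn (avoids321 ∘ contains⇒occ321 (maxFirst k))
                       (avoids1423 ∘ contains⇒occ1423 (maxFirst k)) (avoids3124 ∘ contains⇒occ3124 (maxFirst k))
  where open MaxFirst k

module MaxFirstUnique {k} (w : Word (4 + k)) (perm : IsPerm w) (fish : Fishburn w)
  (av321 : ¬ Occ321 w) (av1423 : ¬ Occ1423 w) (av3124 : ¬ Occ3124 w) (3≤a : 3 ≤ val w zero) where

  private
    a = val w zero

  secondValue : val w (suc zero) ≡ 0
  secondValue = second≡0 w perm av321 fish (<-trans z<s 3≤a)

  private
    beyond : ∀ {i v} → val w i ≡ v → v ≢ a → v ≢ 0 → 1 < toℕ i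
    beyond w≡v v≢a v≢0 = beyondFirstTwo w (λ e → v≢a (trans (sym w≡v) e)) (λ e → v≢0 (trans (sym w≡v) (trans e secondValue)))

  head≡max : a ≡ 3 + k
  head≡max with a ≟ 3 + k
  ... | yes a≡max = a≡max
  -- the value 3 + k lies before the value 1 (a 1423 with 0, 1, 2) or after it (a 3124 with a, 0, 1)
  ... | no  a≢max with positionOf w perm 1 (s<s z<s) | positionOf w perm 2 (s<s (s<s z<s)) | positionOf w perm (3 + k) ≤-refl
  ...   | j₁ , w≡1 | j₂ , w≡2 | jₘ , w≡max = ⊥-elim contradiction
    where
    a<max : a < 3 + k
    a<max = ≤∧≢⇒< (s≤s⁻¹ (toℕ<n (lookup w zero))) a≢max
    1<j₁ = beyond w≡1 (<⇒≢ (<-trans (s<s z<s) 3≤a)) (λ ())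
    1<j₂ = beyond w≡2 (<⇒≢ 3≤a) (λ ())
    1<jₘ = beyond w≡max (a≢max ∘ sym) (λ ())
    v₀<v₁ = subst₂ _<_ (sym secondValue) (sym w≡1) z<s
    v₁<v₂ = subst₂ _<_ (sym w≡1) (sym w≡2) (s<s z<s)
    j₁<j₂ : toℕ j₁ < toℕ j₂
    j₁<j₂ with <-cmp (toℕ j₁) (toℕ j₂)
    ... | tri< lt _ _ = lt
    ... | tri≈ _ eq _ = case trans (sym w≡1) (trans (cong (val w) (toℕ-injective eq)) w≡2) of λ ()
    ... | tri> _ _ gt = ⊥-elim (av321 (zero , j₂ , j₁ , <-trans z<s 1<j₂ , gt , subst (_< a) (sym w≡2) 3≤a , v₁<v₂))
    contradiction : ⊥
    contradiction with <-cmp (toℕ jₘ) (toℕ j₁)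
    ... | tri< jₘ<j₁ _ _ = av1423 (suc zero , jₘ , j₁ , j₂ , 1<jₘ , jₘ<j₁ , j₁<j₂ , v₀<v₁ , v₁<v₂ ,
                                   subst₂ _<_ (sym w≡2) (sym w≡max) (s<s (s<s (s<s z≤n))))
    ... | tri≈ _ eq _    = case trans (sym w≡1) (trans (cong (val w) (toℕ-injective (sym eq))) w≡max) of λ ()
    ... | tri> _ _ j₁<jₘ = av3124 (zero , suc zero , j₁ , jₘ , z<s , 1<j₁ , j₁<jₘ , v₀<v₁ ,
                                   subst (_< a) (sym w≡1) (<-trans (s<s z<s) 3≤a) , subst (a <_) (sym w≡max) a<max)

  tail<head : ∀ r → val w (suc r) < a
  tail<head r = ≤∧≢⇒< (subst (val w (suc r) ≤_) (sym head≡max) (s≤s⁻¹ (toℕ<n (lookup w (suc r))))) (val-≢ w perm λ ())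

  tail-ascending : Ascending (val w ∘ suc)
  tail-ascending b with <-cmp (val w (suc (inject₁ b))) (val w (suc (suc b)))
  ... | tri< lt _ _ = lt
  ... | tri≈ _ eq _ = ⊥-elim (val-≢ w perm (<⇒≢ (s<s (FP.≤̄⇒inject₁< ≤-refl))) eq)
  ... | tri> _ _ gt = ⊥-elim (av321 (zero , suc (inject₁ b) , suc (suc b) , z<s , s<s (FP.≤̄⇒inject₁< ≤-refl) , tail<head _ , gt))

  ≗maxFirst : ∀ i → val w i ≡ val (maxFirst k) i
  ≗maxFirst zero    = trans head≡max (sym (MaxFirst.val-head k))
  ≗maxFirst (suc r) = trans (ascending-squeeze (val w ∘ suc) tail-ascending z≤n last<max r) (sym (MaxFirst.val-tail k r))
    where last<max = subst (val w (suc (fromℕ (2 + k))) <_) head≡max (tail<head _)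

-- 3 1 4 5 ⋯ n 2 in 1-based one-line notation
twoFirst : ∀ k → Word (4 + k)
twoFirst k = suc (suc zero) ∷ zero ∷ (tabulate (λ r → suc (suc (suc r))) ∷ʳ suc zero)

data TwoFirstPosition {k} : Fin (4 + k) → Set where
  first  : TwoFirstPosition zero
  second : TwoFirstPosition (suc zero)
  middle : ∀ r → TwoFirstPosition (suc (suc (inject₁ r)))
  final  : TwoFirstPosition (suc (suc (fromℕ (suc k))))

twoFirstPosition : ∀ {k} (i : Fin (4 + k)) → TwoFirstPosition i
twoFirstPosition zero          = first
twoFirstPosition (suc zero)    = second
twoFirstPosition (suc (suc j)) with Top.view j
... | ‵fromℕ     = final
... | ‵inject₁ r = middle r

module TwoFirst (k : ℕ) where

  value : ∀ {i} → TwoFirstPosition {k} i → ℕ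
  value first      = 2
  value second     = 0
  value (middle r) = 3 + toℕ r
  value final      = 1

  val≡value : ∀ {i} (p : TwoFirstPosition i) → val (twoFirst k) i ≡ value p
  val≡value first      = refl
  val≡value second     = refl
  val≡value (middle r) = cong toℕ (trans (lookup-∷ʳ-inject₁ (tabulate (λ r → suc (suc (suc r)))) _ r)
                                         (lookup∘tabulate (λ r → suc (suc (suc r))) r))
  val≡value final      = cong toℕ (lookup-∷ʳ-fromℕ (tabulate (λ r → suc (suc (suc r)))) _)

  toℕ-middle : ∀ r → toℕ {4 + k} (suc (suc (inject₁ r))) ≡ 2 + toℕ r
  toℕ-middle r = cong (2 +_) (FP.toℕ-inject₁ r)

  toℕ-final : toℕ {4 + k} (suc (suc (fromℕ (suc k)))) ≡ 3 + k
  toℕ-final = cong (2 +_) (FP.toℕ-fromℕ (suc k))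

  value-injective : ∀ {i j} (p : TwoFirstPosition i) (q : TwoFirstPosition j) → value p ≡ value q → i ≡ j
  value-injective first      first      _ = refl
  value-injective second     second     _ = refl
  value-injective final      final      _ = refl
  value-injective (middle r) (middle s) e = cong (λ r → suc (suc (inject₁ r))) (toℕ-injective (+-cancelˡ-≡ 3 _ _ e))

  isPerm : IsPerm (twoFirst k)
  isPerm {x} {y} e = value-injective p q (trans (sym (val≡value p)) (trans (cong toℕ e) (val≡value q)))
    where
    p = twoFirstPosition x
    q = twoFirstPosition y

  atMostFinal : ∀ y → toℕ y ≤ toℕ {4 + k} (suc (suc (fromℕ (suc k))))
  atMostFinal y = subst (toℕ y ≤_) (sym toℕ-final) (s≤s⁻¹ (toℕ<n y))

  value-inversion : ∀ {x y} (p : TwoFirstPosition x) (q : TwoFirstPosition y) → toℕ x < toℕ y → value q < value p →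
                    value q ≤ 1 × 2 ≤ value p
  value-inversion first      second     _   _ = z≤n , ≤-refl
  value-inversion first      final      _   _ = ≤-refl , ≤-refl
  value-inversion (middle r) final      _   _ = ≤-refl , s≤s (s≤s z≤n)
  value-inversion first      (middle s) _   (s≤s (s≤s ()))
  value-inversion (middle r) second     (s≤s ()) _
  value-inversion (middle r) (middle s) x<y v<v =
    ⊥-elim (<-asym (subst₂ _<_ (FP.toℕ-inject₁ r) (FP.toℕ-inject₁ s) (s<s⁻¹ (s<s⁻¹ x<y))) (+-cancelˡ-< 3 _ _ v<v))
  value-inversion {y = y} final q x<y _ = ⊥-elim (<⇒≱ x<y (atMostFinal y))

  inversion : ∀ {x y} → toℕ x < toℕ y → val (twoFirst k) y < val (twoFirst k) x → val (twoFirst k) y ≤ 1 × 2 ≤ val (twoFirst k) x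
  inversion {x} {y} x<y vy<vx =
    let (vq≤1 , 2≤vp) = value-inversion p q x<y (subst₂ _<_ (val≡value q) (val≡value p) vy<vx)
    in subst (_≤ 1) (sym (val≡value q)) vq≤1 , subst (2 ≤_) (sym (val≡value p)) 2≤vp
    where
    p = twoFirstPosition x
    q = twoFirstPosition y

  valueAt : ∀ {x} (p : TwoFirstPosition x) {y} → val (twoFirst k) y ≡ value p → y ≡ x
  valueAt p e = isPerm (toℕ-injective (trans e (sym (val≡value p))))

  fishburn : Fishburn (twoFirst k)
  fishburn (x , y , x' , x'≡1+x , x<y , vy<vx , vx<vx' , vx≡1+vy)
    with valueAt first {x} (≤-antisym (subst (_≤ 2) (sym vx≡1+vy) (s≤s (proj₁ (inversion x<y vy<vx))))
                                  (proj₂ (inversion x<y vy<vx)))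
  ... | refl with toℕ-injective {i = x'} {j = suc zero} x'≡1+x
  ...   | refl = n≮0 vx<vx'

  avoids321 : ¬ Occ321 (twoFirst k)
  avoids321 (_ , _ , _ , i<j , j<k , vj<vi , vk<vj) =
    case ≤-trans (proj₂ (inversion j<k vk<vj)) (proj₁ (inversion i<j vj<vi)) of λ { (s≤s ()) }

  avoids1423 : ¬ Occ1423 (twoFirst k)
  avoids1423 (_ , _ , _ , _ , _ , j<k , k<l , vi<vk , vk<vl , vl<vj) =
    n≮0 (<-≤-trans vi<vk (s≤s⁻¹ (<-≤-trans vk<vl (proj₁ (inversion (<-trans j<k k<l) vl<vj)))))

  avoids3124 : ¬ Occ3124 (twoFirst k)
  avoids3124 (_ , _ , k' , l , i<j , j<k , k<l , vj<vk , vk<vi , _)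
    with valueAt final {k'} (≤-antisym (proj₁ (inversion (<-trans i<j j<k) vk<vi)) (≤-<-trans z≤n vj<vk))
  ... | refl = <⇒≱ k<l (atMostFinal l)

twoFirst-fishAvoid : ∀ k → FishAvoid (4 + k)
twoFirst-fishAvoid k = fa (twoFirst k) isPerm fishburn (avoids321 ∘ contains⇒occ321 (twoFirst k))
                       (avoids1423 ∘ contains⇒occ1423 (twoFirst k)) (avoids3124 ∘ contains⇒occ3124 (twoFirst k))
  where open TwoFirst k

module TwoFirstUnique {k} (w : Word (4 + k)) (perm : IsPerm w) (fish : Fishburn w)
  (av321 : ¬ Occ321 w) (av3124 : ¬ Occ3124 w) (a≡2 : val w zero ≡ 2) where

  open TwoFirst k using (value; val≡value; toℕ-middle; toℕ-final)

  private
    mid : Fin (suc k) → Fin (4 + k)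
    mid r = suc (suc (inject₁ r))
    fin : Fin (4 + k)
    fin = suc (suc (fromℕ (suc k)))
    differ : ∀ {i j v} → toℕ i ≢ toℕ j → val w j ≡ v → val w i ≢ v
    differ i≢j w≡v e = val-≢ w perm i≢j (trans e (sym w≡v))

  secondValue : val w (suc zero) ≡ 0
  secondValue = second≡0 w perm av321 fish (subst (0 <_) (sym a≡2) z<s)

  finalValue : val w fin ≡ 1
  finalValue with positionOf w perm 1 (s<s z<s)
  ... | j₁ , w≡1 with toℕ j₁ ≟ 3 + k
  ...   | yes j₁≡ = subst (λ j → val w j ≡ 1) (toℕ-injective (trans j₁≡ (sym toℕ-final))) w≡1
  ...   | no  j₁≢ = ⊥-elim (av3124 (zero , suc zero , j₁ , fin , z<s , 1<j₁ , j₁<fin ,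
                                    subst₂ _<_ (sym secondValue) (sym w≡1) z<s , subst₂ _<_ (sym w≡1) (sym a≡2) (s<s z<s) ,
                                    subst (_< val w fin) (sym a≡2) 3≤final))
    where
    1<j₁ = beyondFirstTwo w (λ e → case trans (sym w≡1) (trans e a≡2) of λ ()) (λ e → case trans (sym w≡1) (trans e secondValue) of λ ())
    j₁<fin : toℕ j₁ < toℕ fin
    j₁<fin = subst (toℕ j₁ <_) (sym toℕ-final) (≤∧≢⇒< (s≤s⁻¹ (toℕ<n j₁)) j₁≢)
    3≤final = 3≤-from≢ (differ {j = suc zero} (λ e → case trans (sym toℕ-final) e of λ ()) secondValue)
                       (differ (λ e → j₁≢ (trans (sym e) toℕ-final)) w≡1)
                       (differ {j = zero} (λ e → case trans (sym toℕ-final) e of λ ()) a≡2)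

  middle≥3 : ∀ r → 3 ≤ val w (mid r)
  middle≥3 r = 3≤-from≢ (differ {j = suc zero} (λ e → case trans (sym (toℕ-middle r)) e of λ ()) secondValue)
                        (differ {j = fin} (λ e → <⇒≢ (s<s (s<s (toℕ<n r))) (trans (sym (toℕ-middle r)) (trans e toℕ-final))) finalValue)
                        (differ {j = zero} (λ e → case trans (sym (toℕ-middle r)) e of λ ()) a≡2)

  middle-ascending : Ascending (val w ∘ mid)
  middle-ascending b with <-cmp (val w (mid (inject₁ b))) (val w (mid (suc b)))
  ... | tri< lt _ _ = lt
  ... | tri≈ _ eq _ = ⊥-elim (val-≢ w perm (<⇒≢ step) eq)
    where step = s<s (s<s (FP.≤̄⇒inject₁< ≤-refl))
  ... | tri> _ _ gt = ⊥-elim (av321 (mid (inject₁ b) , mid (suc b) , fin , s<s (s<s (FP.≤̄⇒inject₁< ≤-refl)) ,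
                                     subst₂ _<_ (sym (toℕ-middle (suc b))) (sym toℕ-final) (s<s (s<s (s<s (toℕ<n b)))) ,
                                     gt , subst (_< val w (mid (suc b))) (sym finalValue) (<-≤-trans (s<s z<s) (middle≥3 (suc b)))))

  valueOf : ∀ {i} (p : TwoFirstPosition i) → val w i ≡ value p
  valueOf first      = a≡2
  valueOf second     = secondValue
  valueOf (middle r) = ascending-squeeze (val w ∘ mid) middle-ascending (middle≥3 zero) (toℕ<n (lookup w (mid (fromℕ k)))) r
  valueOf final      = finalValue

  ≗twoFirst : ∀ i → val w i ≡ val (twoFirst k) i
  ≗twoFirst i = trans (valueOf (twoFirstPosition i)) (sym (val≡value (twoFirstPosition i)))

module _ {k : ℕ} where
  open FishAvoid

  -- The fields of t are irrelevant, so the equation is recomputed by deciding it.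
  twoFirst-unique : (t : FishAvoid (4 + k)) → val (word t) zero ≡ 2 → twoFirst k ≡ word t
  twoFirst-unique (fa w perm fish av321 _ av3124) a≡2 = recompute (≡-dec F._≟_ _ _)
    (sym (≗⇒≡ (TwoFirstUnique.≗twoFirst w perm fish (av321 ∘ occ321⇒contains w) (av3124 ∘ occ3124⇒contains w) a≡2)))

  maxFirst-unique : (t : FishAvoid (4 + k)) → 3 ≤ val (word t) zero → maxFirst k ≡ word t
  maxFirst-unique (fa w perm fish av321 av1423 av3124) 3≤a = recompute (≡-dec F._≟_ _ _)
    (sym (≗⇒≡ (MaxFirstUnique.≗maxFirst w perm fish (av321 ∘ occ321⇒contains w) (av1423 ∘ occ1423⇒contains w)
                                  (av3124 ∘ occ3124⇒contains w) 3≤a)))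

  classify : FishAvoid (4 + k) → Fish321-312 (4 + k) ⊎ Fin 2
  classify (fa u@(zero ∷ xs) perm fish av321 av1423 _) =
    inj₁ (mk u (isFish-afterPrefix π1-isFish zero (cong (zero ∷_) (↑ʳ-strip 1 xs (aboveOne perm))) perm fish av321 av1423))
  classify (fa u@(suc zero ∷ zero ∷ xs) perm fish av321 av1423 _) =
    inj₁ (mk u (isFish-afterPrefix π21-isFish zero (cong (λ ys → suc zero ∷ zero ∷ ys) (↑ʳ-strip 2 xs (aboveTwo perm)))
                                   perm fish av321 av1423))
  classify (fa u@(suc zero ∷ suc _ ∷ _) perm fish av321 _ _) =
    ⊥-elim-irr (0≢1+n (sym (second≡0 u perm (av321 ∘ occ321⇒contains u) fish z<s)))
  classify (fa (suc (suc zero) ∷ _) _ _ _ _ _)      = inj₂ zero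
  classify (fa (suc (suc (suc _)) ∷ _) _ _ _ _ _)   = inj₂ (suc zero)

  unclassify : Fish321-312 (4 + k) ⊎ Fin 2 → FishAvoid (4 + k)
  unclassify (inj₁ t)          = toFishAvoid t
  unclassify (inj₂ zero)       = twoFirst-fishAvoid k
  unclassify (inj₂ (suc zero)) = maxFirst-fishAvoid k

  classify∘unclassify : ∀ x → classify (unclassify x) ≡ x
  classify∘unclassify (inj₁ (mk u f)) with start u f
  ... | start0 _  = refl
  ... | start10 _ = refl
  classify∘unclassify (inj₂ zero)       = refl
  classify∘unclassify (inj₂ (suc zero)) = refl

  unclassify∘classify : ∀ t → unclassify (classify t) ≡ t
  unclassify∘classify (fa (zero ∷ _) _ _ _ _ _)               = refl
  unclassify∘classify (fa (suc zero ∷ zero ∷ _) _ _ _ _ _)    = refl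
  unclassify∘classify (fa u@(suc zero ∷ suc _ ∷ _) perm fish av321 _ _) =
    ⊥-elim-irr (0≢1+n (sym (second≡0 u perm (av321 ∘ occ321⇒contains u) fish z<s)))
  unclassify∘classify t@(fa (suc (suc zero) ∷ _) _ _ _ _ _)    = FishAvoid-≡ (twoFirst-unique t refl)
  unclassify∘classify t@(fa (suc (suc (suc _)) ∷ _) _ _ _ _ _) = FishAvoid-≡ (maxFirst-unique t (s≤s (s≤s (s≤s z≤n))))

  classify-↔ : FishAvoid (4 + k) ↔ (Fish321-312 (4 + k) ⊎ Fin 2)
  classify-↔ = mk↔ₛ′ classify unclassify classify∘unclassify unclassify∘classify

theorem3p9 : (n : ℕ) → 4 ≤ n → Fin (fib n + 2) ↔ FishAvoid n
theorem3p9 .(4 + k) (s≤s (s≤s (s≤s (s≤s {n = k} _)))) =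
  ↔-trans FP.+↔⊎ (↔-trans (fib↔Fish321-312 (4 + k) ⊎-↔ ↔-refl) (↔-sym classify-↔))
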